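{- Let $P=P_0*P_1*\cdots*P_k\subset\mathbb{R}^{n-k}\oplus\mathbb{R}^k$ be a $B_k$-polytope. Suppose that $\dim P_i\ge1$ for all $i=0,\dots,k$ and that $P_0$ is not a join. Then $P$ is not a join.
   Context: Cayley sum: for lattice polytopes $P_0,\dots,P_k\subset\mathbb{R}^{n-k}$, $P_0*\cdots*P_k=\mathrm{conv}\big((P_0\times\{0\})\cup\bigcup_{i=1}^k(P_i\times\{e_i\})\big)$, with $e_1,\dots,e_k$ the standard basis of $\mathbb{R}^k$. It is a $B_k$-polytope if $\dim(P_1+\dots+P_k)<k$ (Minkowski sum) and $\dim P_0=n-k$. A lattice polytope $P$ is the join of two non-empty faces $Q_1,Q_2$ if the linear spans of $Q_1-Q_1$ and $Q_2-Q_2$ intersect only in $0$, $Q_1\cap Q_2=\emptyset$, and $\mathrm{conv}(Q_1\cup Q_2)=P$; $P$ is a join if it is the join of some two non-empty faces.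
   Formalization: The polytopes $P_i$, their Cayley sum and all faces, spans of differences and convex hulls are taken as sets of points with rational coordinates, in ℚ^n rather than $\mathbb{R}^{n-k}\oplus\mathbb{R}^k$. -}

module Defs where

open import Data.Nat using (ℕ; zero; suc)
open import Data.Fin using (Fin; zero; suc)
open import Data.Integer using (ℤ)
open import Data.Rational using (ℚ; 0ℚ; 1ℚ; _+_; _*_; _-_; _≤_; _/_)
open import Data.Product using (Σ; ∃; _×_; _,_)
open import Data.Sum using (_⊎_)
open import Data.Empty using (⊥)
open import Relation.Nullary using (¬_)
open import Relation.Binary.PropositionalEquality using (_≡_)
open import Data.Vec.Functional using (_++_)
open import Level using (0ℓ)
open import Relation.Unary using (Pred)

Point : ℕ → Set
Point m = Fin m → ℚ

_≈_ : ∀ {m} → Point m → Point m → Set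
x ≈ y = ∀ i → x i ≡ y i

0ᵥ : ∀ {m} → Point m
0ᵥ _ = 0ℚ

_+ᵥ_ : ∀ {m} → Point m → Point m → Point m
(x +ᵥ y) i = x i + y i

_-ᵥ_ : ∀ {m} → Point m → Point m → Point m
(x -ᵥ y) i = x i - y i

_·ᵥ_ : ∀ {m} → ℚ → Point m → Point m
(c ·ᵥ x) i = c * x i

basis : ∀ {k} → Fin k → Point k
basis zero zero = 1ℚ
basis zero (suc _) = 0ℚ
basis (suc j) zero = 0ℚ
basis (suc j) (suc i) = basis j i

dot : ∀ {m} → Point m → Point m → ℚ
dot {zero} x y = 0ℚ
dot {suc m} x y = x zero * y zero + dot {m} (λ i → x (suc i)) (λ i → y (suc i))

sumℚ : ∀ {r} → (Fin r → ℚ) → ℚ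
sumℚ {zero} f = 0ℚ
sumℚ {suc r} f = f zero + sumℚ {r} (λ i → f (suc i))

sumᵥ : ∀ {r m} → (Fin r → Point m) → Point m
sumᵥ {zero} f = 0ᵥ
sumᵥ {suc r} f = f zero +ᵥ sumᵥ {r} (λ i → f (suc i))

PSet : ℕ → Set₁
PSet m = Pred (Point m) 0ℓ

Conv : ∀ {m} → PSet m → PSet m
Conv {m} S y =
  Σ ℕ λ r → Σ (Fin r → ℚ) λ c → Σ (Fin r → Point m) λ x →
    (∀ i → 0ℚ ≤ c i) × (sumℚ c ≡ 1ℚ) × (∀ i → S (x i)) ×
    (y ≈ sumᵥ (λ i → c i ·ᵥ x i))

record LatticePolytope (m : ℕ) : Set where
  field
    N : ℕ
    vert : Fin N → Fin m → ℤ
open LatticePolytope public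

toℚ : ℤ → ℚ
toℚ z = z / 1

set : ∀ {m} → LatticePolytope m → PSet m
set {m} P = Conv (λ y → Σ (Fin (N P)) λ j → y ≈ (λ i → toℚ (vert P j i)))

LinIndep : ∀ {r m} → (Fin r → Point m) → Set
LinIndep {r} v = ∀ (c : Fin r → ℚ) → sumᵥ (λ j → c j ·ᵥ v j) ≈ 0ᵥ → ∀ j → c j ≡ 0ℚ

DimAtLeast : ∀ {m} → PSet m → ℕ → Set
DimAtLeast {m} S r = Σ (Fin (suc r) → Point m) λ p →
  (∀ i → S (p i)) × LinIndep (λ (j : Fin r) → p (suc j) -ᵥ p zero)

-- dim S = r  (the empty set has dimension -1, i.e. DimAtLeast S 0 fails)
DimEq : ∀ {m} → PSet m → ℕ → Set
DimEq S r = DimAtLeast S r × ¬ DimAtLeast S (suc r)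

MinkowskiSum : ∀ {k m} → (Fin k → PSet m) → PSet m
MinkowskiSum {k} {m} S y = Σ (Fin k → Point m) λ x → (∀ i → S i (x i)) × (y ≈ sumᵥ x)

IsFace : ∀ {m} → PSet m → PSet m → Set
IsFace {m} P Q = Σ (Point m) λ c → Σ ℚ λ b →
  (∀ x → P x → dot c x ≤ b) ×
  (∀ x → (Q x → P x × dot c x ≡ b) × (P x × dot c x ≡ b → Q x))

NonEmpty : ∀ {m} → PSet m → Set
NonEmpty {m} Q = Σ (Point m) Q

SpanDiff : ∀ {m} → PSet m → PSet m
SpanDiff {m} Q v = Σ ℕ λ r → Σ (Fin r → ℚ) λ c → Σ (Fin r → Point m) λ x →
  Σ (Fin r → Point m) λ y → (∀ i → Q (x i) × Q (y i)) ×
  (v ≈ sumᵥ (λ i → c i ·ᵥ (x i -ᵥ y i)))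

IsJoinOf : ∀ {m} → PSet m → PSet m → PSet m → Set
IsJoinOf {m} P Q₁ Q₂ =
  IsFace P Q₁ × IsFace P Q₂ × NonEmpty Q₁ × NonEmpty Q₂ ×
  (∀ v → SpanDiff Q₁ v → SpanDiff Q₂ v → v ≈ 0ᵥ) ×
  (∀ x → Q₁ x → Q₂ x → ⊥) ×
  (∀ x → (Conv (λ y → Q₁ y ⊎ Q₂ y) x → P x) × (P x → Conv (λ y → Q₁ y ⊎ Q₂ y) x))

IsJoin : ∀ {m} → PSet m → Set₁
IsJoin {m} P = Σ (PSet m) λ Q₁ → Σ (PSet m) λ Q₂ → IsJoinOf P Q₁ Q₂

-- Cayley sums and B_k-polytopes  (n = d + k, P_i ⊂ ℝ^d)

height : ∀ {k} → Fin (suc k) → Point k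
height zero = 0ᵥ
height (suc j) = basis j

Cayley : ∀ d k → (Fin (suc k) → LatticePolytope d) → PSet (d Data.Nat.+ k)
Cayley d k P = Conv (λ y → Σ (Fin (suc k)) λ i → Σ (Point d) λ p →
  set (P i) p × (y ≈ (p ++ height i)))

IsBk : ∀ d k → (Fin (suc k) → LatticePolytope d) → Set
IsBk d k P =
  ¬ DimAtLeast (MinkowskiSum (λ (i : Fin k) → set (P (suc i)))) k ×
  DimEq (set (P zero)) d

module Submission where

-- Suppose faces Q₁, Q₂ exhibit the Cayley sum C as a join. The level functionals cut out the faces
-- P i × {height i} of C; tracing Q₁ and Q₂ on the base face P₀ × {0} gives faces of P₀, which exhibit
-- P₀ as a join as soon as both are nonempty. If, say, the trace of Q₂ is empty, then every point of
-- P₀ × {0}, being a convex combination of points of Q₁ ∪ Q₂ on that face, lies in Q₁. As P₀ is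
-- full-dimensional, the normal of Q₁ then has no horizontal part and its bound is 0. A nonzero height
-- coefficient would push P (suc j) × {e_j} into Q₂, and an edge direction of P (suc j) would then lie in
-- the difference spans of both Q₁ and Q₂. So the normal vanishes, Q₁ = C ⊇ Q₂, contradicting
-- disjointness.

open import Defs
open import Algebra.Bundles using (Ring)
open import Data.Nat using (ℕ; zero; suc)
import Data.Nat as ℕ
open import Data.Fin using (Fin; zero; suc; splitAt; join; _↑ˡ_; _↑ʳ_; punchIn)
import Data.Fin.Properties as FinP
open import Data.Product using (Σ; ∃; _×_; _,_; proj₁; proj₂)
open import Data.Rational using (ℚ; 0ℚ; 1ℚ; _+_; _*_; _-_; -_; _≤_; 1/_; NonZero; ≢-nonZero; nonNegative; nonPositive)
import Data.Rational.Properties as QP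
open import Data.Rational.Solver using (module +-*-Solver)
open import Data.Sum using (_⊎_; inj₁; inj₂; [_,_]′; reduce; map₂; swap)
open import Data.Empty using (⊥; ⊥-elim)
open import Data.Vec.Functional using (_++_; _∷_; removeAt; insertAt)
open import Data.Vec.Functional.Properties using (lookup-++ˡ; ++-injectiveˡ; insertAt-lookup; insertAt-punchIn)
open import Function using (_∘_)
open import Relation.Nullary using (¬_; yes; no; ¬?)
open import Relation.Nullary.Decidable using (decidable-stable)
open import Relation.Binary.PropositionalEquality
open import Relation.Unary using (_∪_)

open import Algebra.Properties.Semiring.Sum (Ring.semiring QP.+-*-ring)
  using (sum; sum-remove; ∑-distrib-+; *-distribˡ-sum; *-distribʳ-sum)
open +-*-Solver

p*q≡0⇒p≡0∨q≡0 : ∀ p q → p * q ≡ 0ℚ → p ≡ 0ℚ ⊎ q ≡ 0ℚ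
p*q≡0⇒p≡0∨q≡0 p q pq≡0 with p QP.≟ 0ℚ
... | yes p≡0 = inj₁ p≡0
... | no p≢0 = inj₂ (begin
  q                ≡⟨ QP.*-identityˡ q ⟨
  1ℚ * q           ≡⟨ cong (_* q) (QP.*-inverseˡ p) ⟨
  (1/ p * p) * q   ≡⟨ QP.*-assoc (1/ p) p q ⟩
  1/ p * (p * q)   ≡⟨ cong (1/ p *_) pq≡0 ⟩
  1/ p * 0ℚ        ≡⟨ QP.*-zeroʳ (1/ p) ⟩
  0ℚ               ∎)
  where
  open ≡-Reasoning
  instance
    p-nonZero : NonZero p
    p-nonZero = ≢-nonZero p≢0

p*p≡0⇒p≡0 : ∀ p → p * p ≡ 0ℚ → p ≡ 0ℚ
p*p≡0⇒p≡0 p pp≡0 = reduce (p*q≡0⇒p≡0∨q≡0 p p pp≡0)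

0≤p*q : ∀ {p q} → 0ℚ ≤ p → 0ℚ ≤ q → 0ℚ ≤ p * q
0≤p*q {p} {q} 0≤p 0≤q =
  QP.nonNegative⁻¹ (p * q) {{QP.nonNeg*nonNeg⇒nonNeg p {{nonNegative 0≤p}} q {{nonNegative 0≤q}}}}

0≤p*p : ∀ p → 0ℚ ≤ p * p
0≤p*p p with QP.≤-total 0ℚ p
... | inj₁ 0≤p = 0≤p*q 0≤p 0≤p
... | inj₂ p≤0 = QP.nonNegative⁻¹ (p * p) {{QP.nonPos*nonPos⇒nonPos p {{nonPositive p≤0}} p {{nonPositive p≤0}}}}

p≤p+q : ∀ p {q} → 0ℚ ≤ q → p ≤ p + q
p≤p+q p {q} 0≤q = subst (_≤ p + q) (QP.+-identityʳ p) (QP.+-monoʳ-≤ p 0≤q)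

p≤q⇒0≤q-p : ∀ {p q} → p ≤ q → 0ℚ ≤ q - p
p≤q⇒0≤q-p {p} {q} p≤q = subst (_≤ q - p) (QP.+-inverseʳ p) (QP.+-monoˡ-≤ (- p) p≤q)

0≤q-p⇒p≤q : ∀ {p q} → 0ℚ ≤ q - p → p ≤ q
0≤q-p⇒p≤q {p} {q} 0≤q-p =
  subst₂ _≤_ (QP.+-identityˡ p) (solve 2 (λ p q → (q :- p) :+ p := q) refl p q) (QP.+-monoˡ-≤ p 0≤q-p)

q-p≡0⇒p≡q : ∀ {p q} → q - p ≡ 0ℚ → p ≡ q
q-p≡0⇒p≡q {p} {q} q-p≡0 = begin
  p              ≡⟨ QP.+-identityˡ p ⟨
  0ℚ + p         ≡⟨ cong (_+ p) q-p≡0 ⟨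
  (q - p) + p    ≡⟨ solve 2 (λ p q → (q :- p) :+ p := q) refl p q ⟩
  q              ∎
  where open ≡-Reasoning

sumℚ≡sum : ∀ {r} (f : Fin r → ℚ) → sumℚ f ≡ sum f
sumℚ≡sum {zero} f = refl
sumℚ≡sum {suc r} f = cong (f zero +_) (sumℚ≡sum (f ∘ suc))

sumℚ-cong : ∀ {r} {f g : Fin r → ℚ} → (∀ i → f i ≡ g i) → sumℚ f ≡ sumℚ g
sumℚ-cong {zero} f≗g = refl
sumℚ-cong {suc r} f≗g = cong₂ _+_ (f≗g zero) (sumℚ-cong (f≗g ∘ suc))

sumℚ-+ : ∀ {r} (f g : Fin r → ℚ) → sumℚ (λ i → f i + g i) ≡ sumℚ f + sumℚ g
sumℚ-+ f g rewrite sumℚ≡sum (λ i → f i + g i) | sumℚ≡sum f | sumℚ≡sum g = ∑-distrib-+ f g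

sumℚ-*ˡ : ∀ {r} a (f : Fin r → ℚ) → sumℚ (λ i → a * f i) ≡ a * sumℚ f
sumℚ-*ˡ a f rewrite sumℚ≡sum (λ i → a * f i) | sumℚ≡sum f = sym (*-distribˡ-sum a f)

sumℚ-*ʳ : ∀ {r} a (f : Fin r → ℚ) → sumℚ (λ i → f i * a) ≡ sumℚ f * a
sumℚ-*ʳ a f rewrite sumℚ≡sum (λ i → f i * a) | sumℚ≡sum f = sym (*-distribʳ-sum a f)

sumℚ-neg : ∀ {r} (f : Fin r → ℚ) → sumℚ (λ i → - f i) ≡ - sumℚ f
sumℚ-neg {zero} f = refl
sumℚ-neg {suc r} f rewrite sumℚ-neg (f ∘ suc) = sym (QP.neg-distrib-+ (f zero) _)

sumℚ-- : ∀ {r} (f g : Fin r → ℚ) → sumℚ (λ i → f i - g i) ≡ sumℚ f - sumℚ g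
sumℚ-- f g = trans (sumℚ-+ f (λ i → - g i)) (cong (sumℚ f +_) (sumℚ-neg g))

sumℚ-remove : ∀ {r} (f : Fin (suc r) → ℚ) i → sumℚ f ≡ f i + sumℚ (removeAt f i)
sumℚ-remove f i rewrite sumℚ≡sum f | sumℚ≡sum (removeAt f i) = sum-remove f

sumℚ-zero : ∀ {r} (f : Fin r → ℚ) → (∀ i → f i ≡ 0ℚ) → sumℚ f ≡ 0ℚ
sumℚ-zero {zero} f f≗0 = refl
sumℚ-zero {suc r} f f≗0 rewrite f≗0 zero | sumℚ-zero (f ∘ suc) (f≗0 ∘ suc) = refl

sumℚ-nonNeg : ∀ {r} (f : Fin r → ℚ) → (∀ i → 0ℚ ≤ f i) → 0ℚ ≤ sumℚ f
sumℚ-nonNeg {zero} f f≥0 = QP.≤-refl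
sumℚ-nonNeg {suc r} f f≥0 = QP.+-mono-≤ (f≥0 zero) (sumℚ-nonNeg (f ∘ suc) (f≥0 ∘ suc))

sumℚ-nonNeg≡0 : ∀ {r} (f : Fin r → ℚ) → (∀ i → 0ℚ ≤ f i) → sumℚ f ≡ 0ℚ → ∀ i → f i ≡ 0ℚ
sumℚ-nonNeg≡0 {suc r} f f≥0 Σf≡0 i = QP.≤-antisym fᵢ≤0 (f≥0 i)
  where
  fᵢ≤0 : f i ≤ 0ℚ
  fᵢ≤0 = subst (f i ≤_) (trans (sym (sumℚ-remove f i)) Σf≡0)
           (p≤p+q (f i) (sumℚ-nonNeg (removeAt f i) (f≥0 ∘ punchIn i)))

≈-refl : ∀ {m} {x : Point m} → x ≈ x
≈-refl i = refl

≈-sym : ∀ {m} {x y : Point m} → x ≈ y → y ≈ x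
≈-sym x≈y i = sym (x≈y i)

≈-trans : ∀ {m} {x y z : Point m} → x ≈ y → y ≈ z → x ≈ z
≈-trans x≈y y≈z i = trans (x≈y i) (y≈z i)

sumᵥ-lookup : ∀ {r m} (f : Fin r → Point m) i → sumᵥ f i ≡ sumℚ (λ j → f j i)
sumᵥ-lookup {zero} f i = refl
sumᵥ-lookup {suc r} f i = cong (f zero i +_) (sumᵥ-lookup (f ∘ suc) i)

sumᵥ-cong : ∀ {r m} {f g : Fin r → Point m} → (∀ j → f j ≈ g j) → sumᵥ f ≈ sumᵥ g
sumᵥ-cong {f = f} {g} f≈g i =
  trans (sumᵥ-lookup f i) (trans (sumℚ-cong (λ j → f≈g j i)) (sym (sumᵥ-lookup g i)))

++-all : ∀ {A : Set} {m n} (R : A → Set) {f : Fin m → A} {g : Fin n → A} →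
  (∀ i → R (f i)) → (∀ j → R (g j)) → ∀ ι → R ((f ++ g) ι)
++-all {m = m} R Rf Rg ι with splitAt m ι
... | inj₁ i = Rf i
... | inj₂ j = Rg j

++-zipWith : ∀ {A B C : Set} {m n} (_∙_ : A → B → C)
  (f : Fin m → A) (g : Fin n → A) (f′ : Fin m → B) (g′ : Fin n → B) ι →
  ((f ++ g) ι ∙ (f′ ++ g′) ι) ≡ ((λ i → f i ∙ f′ i) ++ (λ j → g j ∙ g′ j)) ι
++-zipWith {m = m} _ f g f′ g′ ι with splitAt m ι
... | inj₁ i = refl
... | inj₂ j = refl

++-suc : ∀ {A : Set} {m n} (f : Fin (suc m) → A) (g : Fin n → A) i →
  (f ++ g) (suc i) ≡ ((f ∘ suc) ++ g) i
++-suc {m = m} f g i with splitAt m i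
... | inj₁ _ = refl
... | inj₂ _ = refl

take++drop : ∀ d k (x : Point (d ℕ.+ k)) → x ≈ ((λ i → x (i ↑ˡ k)) ++ (λ j → x (d ↑ʳ j)))
take++drop d k x ι = trans (cong x (sym (FinP.join-splitAt d k ι))) (by-cases ι)
  where
  by-cases : ∀ ι → x (join d k (splitAt d ι)) ≡ ((λ i → x (i ↑ˡ k)) ++ (λ j → x (d ↑ʳ j))) ι
  by-cases ι with splitAt d ι
  ... | inj₁ i = refl
  ... | inj₂ j = refl

++-difference : ∀ {d k} (x y : Point d) (h : Point k) → ((x ++ h) -ᵥ (y ++ h)) ≈ ((x -ᵥ y) ++ 0ᵥ)
++-difference {d} x y h ι with splitAt d ι
... | inj₁ i = refl
... | inj₂ j = QP.+-inverseʳ (h j)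

sumℚ-++ : ∀ {m n} (f : Fin m → ℚ) (g : Fin n → ℚ) → sumℚ (f ++ g) ≡ sumℚ f + sumℚ g
sumℚ-++ {zero} f g = sym (QP.+-identityˡ _)
sumℚ-++ {suc m} f g = begin
  f zero + sumℚ (λ i → (f ++ g) (suc i))   ≡⟨ cong (f zero +_) (sumℚ-cong (++-suc f g)) ⟩
  f zero + sumℚ ((f ∘ suc) ++ g)           ≡⟨ cong (f zero +_) (sumℚ-++ (f ∘ suc) g) ⟩
  f zero + (sumℚ (f ∘ suc) + sumℚ g)       ≡⟨ QP.+-assoc (f zero) _ _ ⟨
  (f zero + sumℚ (f ∘ suc)) + sumℚ g       ∎
  where open ≡-Reasoning

dot≡sumℚ : ∀ {m} (f x : Point m) → dot f x ≡ sumℚ (λ i → f i * x i)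
dot≡sumℚ {zero} f x = refl
dot≡sumℚ {suc m} f x = cong (f zero * x zero +_) (dot≡sumℚ (f ∘ suc) (x ∘ suc))

dot-cong : ∀ {m} {f f′ x x′ : Point m} → f ≈ f′ → x ≈ x′ → dot f x ≡ dot f′ x′
dot-cong {f = f} {f′} {x} {x′} f≈f′ x≈x′ =
  trans (dot≡sumℚ f x) (trans (sumℚ-cong (λ i → cong₂ _*_ (f≈f′ i) (x≈x′ i))) (sym (dot≡sumℚ f′ x′)))

dot-congʳ : ∀ {m} (f : Point m) {x x′ : Point m} → x ≈ x′ → dot f x ≡ dot f x′
dot-congʳ f = dot-cong {f = f} ≈-refl

dot-zeroʳ : ∀ {m} (f : Point m) → dot f 0ᵥ ≡ 0ℚ
dot-zeroʳ f = trans (dot≡sumℚ f 0ᵥ) (sumℚ-zero _ (λ i → QP.*-zeroʳ (f i)))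

dot-zeroˡ : ∀ {m} (x : Point m) → dot 0ᵥ x ≡ 0ℚ
dot-zeroˡ x = trans (dot≡sumℚ 0ᵥ x) (sumℚ-zero _ (λ i → QP.*-zeroˡ (x i)))

dot-distribʳ-+ : ∀ {m} (f x y : Point m) → dot f (x +ᵥ y) ≡ dot f x + dot f y
dot-distribʳ-+ f x y = begin
  dot f (x +ᵥ y)                                   ≡⟨ dot≡sumℚ f (x +ᵥ y) ⟩
  sumℚ (λ i → f i * (x i + y i))                   ≡⟨ sumℚ-cong (λ i → QP.*-distribˡ-+ (f i) (x i) (y i)) ⟩
  sumℚ (λ i → f i * x i + f i * y i)               ≡⟨ sumℚ-+ (λ i → f i * x i) (λ i → f i * y i) ⟩
  sumℚ (λ i → f i * x i) + sumℚ (λ i → f i * y i)  ≡⟨ cong₂ _+_ (dot≡sumℚ f x) (dot≡sumℚ f y) ⟨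
  dot f x + dot f y                                ∎
  where open ≡-Reasoning

dot-distribʳ-- : ∀ {m} (f x y : Point m) → dot f (x -ᵥ y) ≡ dot f x - dot f y
dot-distribʳ-- f x y = begin
  dot f (x -ᵥ y)                                   ≡⟨ dot≡sumℚ f (x -ᵥ y) ⟩
  sumℚ (λ i → f i * (x i - y i))                   ≡⟨ sumℚ-cong (λ i → solve 3 (λ a b c → a :* (b :- c) := a :* b :- a :* c) refl (f i) (x i) (y i)) ⟩
  sumℚ (λ i → f i * x i - f i * y i)               ≡⟨ sumℚ-- (λ i → f i * x i) (λ i → f i * y i) ⟩
  sumℚ (λ i → f i * x i) - sumℚ (λ i → f i * y i)  ≡⟨ cong₂ _-_ (dot≡sumℚ f x) (dot≡sumℚ f y) ⟨
  dot f x - dot f y                                ∎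
  where open ≡-Reasoning

dot-·ʳ : ∀ {m} (f : Point m) c x → dot f (c ·ᵥ x) ≡ c * dot f x
dot-·ʳ f c x = begin
  dot f (c ·ᵥ x)                ≡⟨ dot≡sumℚ f (c ·ᵥ x) ⟩
  sumℚ (λ i → f i * (c * x i))  ≡⟨ sumℚ-cong (λ i → solve 3 (λ a b e → a :* (b :* e) := b :* (a :* e)) refl (f i) c (x i)) ⟩
  sumℚ (λ i → c * (f i * x i))  ≡⟨ sumℚ-*ˡ c (λ i → f i * x i) ⟩
  c * sumℚ (λ i → f i * x i)    ≡⟨ cong (c *_) (dot≡sumℚ f x) ⟨
  c * dot f x                   ∎
  where open ≡-Reasoning

dot-linearCombination : ∀ {r m} (f : Point m) (c : Fin r → ℚ) (z : Fin r → Point m) →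
  dot f (sumᵥ (λ l → c l ·ᵥ z l)) ≡ sumℚ (λ l → c l * dot f (z l))
dot-linearCombination {zero} f c z = dot-zeroʳ f
dot-linearCombination {suc r} f c z =
  trans (dot-distribʳ-+ f (c zero ·ᵥ z zero) _)
        (cong₂ _+_ (dot-·ʳ f (c zero) (z zero)) (dot-linearCombination f (c ∘ suc) (z ∘ suc)))

dot-++ : ∀ {d k} (f x : Point d) (f′ y : Point k) → dot (f ++ f′) (x ++ y) ≡ dot f x + dot f′ y
dot-++ f x f′ y = begin
  dot (f ++ f′) (x ++ y)                             ≡⟨ dot≡sumℚ (f ++ f′) (x ++ y) ⟩
  sumℚ (λ ι → (f ++ f′) ι * (x ++ y) ι)              ≡⟨ sumℚ-cong (++-zipWith _*_ f f′ x y) ⟩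
  sumℚ ((λ i → f i * x i) ++ (λ j → f′ j * y j))     ≡⟨ sumℚ-++ (λ i → f i * x i) (λ j → f′ j * y j) ⟩
  sumℚ (λ i → f i * x i) + sumℚ (λ j → f′ j * y j)   ≡⟨ cong₂ _+_ (dot≡sumℚ f x) (dot≡sumℚ f′ y) ⟨
  dot f x + dot f′ y                                 ∎
  where open ≡-Reasoning

dot-split : ∀ d k (f : Point (d ℕ.+ k)) x y →
  dot f (x ++ y) ≡ dot (λ i → f (i ↑ˡ k)) x + dot (λ j → f (d ↑ʳ j)) y
dot-split d k f x y = trans (dot-cong {x = x ++ y} (take++drop d k f) ≈-refl) (dot-++ _ x _ y)

dot-basis : ∀ {k} (γ : Point k) (j : Fin k) → dot γ (basis j) ≡ γ j
dot-basis {suc k} γ zero =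
  trans (cong (γ zero * 1ℚ +_) (dot-zeroʳ (γ ∘ suc))) (trans (QP.+-identityʳ _) (QP.*-identityʳ (γ zero)))
dot-basis {suc k} γ (suc j) =
  trans (cong (_+ dot (γ ∘ suc) (basis j)) (QP.*-zeroʳ (γ zero))) (trans (QP.+-identityˡ _) (dot-basis (γ ∘ suc) j))

basis-diagonal : ∀ {k} (j : Fin k) → basis j j ≡ 1ℚ
basis-diagonal zero = refl
basis-diagonal (suc j) = basis-diagonal j

basis-offDiagonal : ∀ {k} (j j′ : Fin k) → j ≢ j′ → basis j j′ ≡ 0ℚ
basis-offDiagonal zero zero j≢j′ = ⊥-elim (j≢j′ refl)
basis-offDiagonal zero (suc j′) _ = refl
basis-offDiagonal (suc j) zero _ = refl
basis-offDiagonal (suc j) (suc j′) j≢j′ = basis-offDiagonal j j′ (j≢j′ ∘ cong suc)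

sumℚ-basis : ∀ {k} (j : Fin k) → sumℚ (basis j) ≡ 1ℚ
sumℚ-basis {suc k} zero = cong (1ℚ +_) (sumℚ-zero (λ i → basis {suc k} zero (suc i)) (λ _ → refl))
sumℚ-basis {suc k} (suc j) = trans (QP.+-identityˡ _) (sumℚ-basis j)

dot-self≡0⇒≈0 : ∀ {m} (x : Point m) → dot x x ≡ 0ℚ → x ≈ 0ᵥ
dot-self≡0⇒≈0 x x·x≡0 i = p*p≡0⇒p≡0 (x i)
  (sumℚ-nonNeg≡0 (λ i → x i * x i) (λ i → 0≤p*p (x i)) (trans (sym (dot≡sumℚ x x)) x·x≡0) i)

-- Linear algebra over ℚ

NontrivialRelation : ∀ {r m} → (Fin r → Point m) → Set
NontrivialRelation {r} {m} v =
  Σ (Fin r → ℚ) λ c → (∀ i → sumℚ (λ j → c j * v j i) ≡ 0ℚ) × ∃ λ l → c l ≢ 0ℚ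

sumℚ-insertAt : ∀ {r} (c : Fin r → ℚ) l κ (x : Fin (suc r) → ℚ) →
  sumℚ (λ j → insertAt c l κ j * x j) ≡ κ * x l + sumℚ (λ j → c j * x (punchIn l j))
sumℚ-insertAt c l κ x =
  trans (sumℚ-remove (λ j → insertAt c l κ j * x j) l)
        (cong₂ _+_ (cong (_* x l) (insertAt-lookup c l κ))
                   (sumℚ-cong (λ j → cong (_* x (punchIn l j)) (insertAt-punchIn c l κ j))))

relation-firstCoordinatesZero : ∀ {r m} (v : Fin (suc r) → Point (suc m)) →
  (∀ l → v l zero ≡ 0ℚ) → NontrivialRelation (λ j i → v (suc j) (suc i)) → NontrivialRelation v
relation-firstCoordinatesZero v v₀≡0 (c , rel , l , cₗ≢0) = insertAt c zero 0ℚ , rel′ , suc l , cₗ≢0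
  where
  relTail : ∀ i → sumℚ (λ j → c j * v (suc j) i) ≡ 0ℚ
  relTail zero = sumℚ-zero _ (λ j → trans (cong (c j *_) (v₀≡0 (suc j))) (QP.*-zeroʳ (c j)))
  relTail (suc i) = rel i
  rel′ : ∀ i → sumℚ (λ j → insertAt c zero 0ℚ j * v j i) ≡ 0ℚ
  rel′ i = begin
    sumℚ (λ j → insertAt c zero 0ℚ j * v j i)      ≡⟨ sumℚ-insertAt c zero 0ℚ (λ j → v j i) ⟩
    0ℚ * v zero i + sumℚ (λ j → c j * v (suc j) i)  ≡⟨ cong (_+ sumℚ (λ j → c j * v (suc j) i)) (QP.*-zeroˡ (v zero i)) ⟩
    0ℚ + sumℚ (λ j → c j * v (suc j) i)             ≡⟨ QP.+-identityˡ _ ⟩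
    sumℚ (λ j → c j * v (suc j) i)                  ≡⟨ relTail i ⟩
    0ℚ                                              ∎
    where open ≡-Reasoning

-- Gaussian elimination: subtract multiples of the pivot vector v l to clear the first coordinate.
reduceByPivot : ∀ {r m} (v : Fin (suc r) → Point (suc m)) l → .{{NonZero (v l zero)}} → Fin r → Point m
reduceByPivot v l j i = v (punchIn l j) (suc i) - (v (punchIn l j) zero * 1/ (v l zero)) * v l (suc i)

relation-pivot : ∀ {r m} (v : Fin (suc r) → Point (suc m)) l .{{_ : NonZero (v l zero)}} →
  NontrivialRelation (reduceByPivot v l) → NontrivialRelation v
relation-pivot v l (c , rel , l′ , c≢0) =
  insertAt c l κ , rel′ , punchIn l l′ , λ e → c≢0 (trans (sym (insertAt-punchIn c l κ l′)) e)
  where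
  α t S κ : ℚ
  α = v l zero
  t = 1/ α
  S = sumℚ (λ j → c j * v (punchIn l j) zero)
  κ = - (S * t)
  rel′ : ∀ i → sumℚ (λ j → insertAt c l κ j * v j i) ≡ 0ℚ
  rel′ zero = begin
    sumℚ (λ j → insertAt c l κ j * v j zero)  ≡⟨ sumℚ-insertAt c l κ (λ j → v j zero) ⟩
    - (S * t) * α + S                         ≡⟨ solve 3 (λ S t α → :- (S :* t) :* α :+ S := S :- S :* (t :* α)) refl S t α ⟩
    S - S * (t * α)                           ≡⟨ cong (λ u → S - S * u) (QP.*-inverseˡ α) ⟩
    S - S * 1ℚ                                ≡⟨ solve 1 (λ S → S :- S :* con 1ℚ := con 0ℚ) refl S ⟩
    0ℚ                                        ∎
    where open ≡-Reasoning
  rel′ (suc i) = begin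
    sumℚ (λ j → insertAt c l κ j * v j (suc i))  ≡⟨ sumℚ-insertAt c l κ (λ j → v j (suc i)) ⟩
    - (S * t) * u + A                            ≡⟨ solve 4 (λ S t u A → :- (S :* t) :* u :+ A := A :- S :* (t :* u)) refl S t u A ⟩
    A - S * (t * u)                              ≡⟨ expand ⟨
    sumℚ (λ j → c j * reduceByPivot v l j i)     ≡⟨ rel i ⟩
    0ℚ                                           ∎
    where
    open ≡-Reasoning
    u A : ℚ
    u = v l (suc i)
    A = sumℚ (λ j → c j * v (punchIn l j) (suc i))
    expand : sumℚ (λ j → c j * reduceByPivot v l j i) ≡ A - S * (t * u)
    expand =
      trans (sumℚ-cong (λ j → solve 5 (λ c a b t u → c :* (a :- (b :* t) :* u) := c :* a :- (c :* b) :* (t :* u)) refl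
                                (c j) (v (punchIn l j) (suc i)) (v (punchIn l j) zero) t u))
      (trans (sumℚ-- (λ j → c j * v (punchIn l j) (suc i)) (λ j → (c j * v (punchIn l j) zero) * (t * u)))
             (cong (λ s → A - s) (sumℚ-*ʳ (t * u) (λ j → c j * v (punchIn l j) zero))))

nontrivialRelation : ∀ d (v : Fin (suc d) → Point d) → NontrivialRelation v
nontrivialRelation zero v = (λ _ → 1ℚ) , (λ ()) , zero , QP.1≢0
nontrivialRelation (suc d) v with FinP.any? (λ l → ¬? (v l zero QP.≟ 0ℚ))
... | yes (l , vₗ≢0) = relation-pivot v l (nontrivialRelation d (reduceByPivot v l))
  where
  instance
    vₗ-nonZero : NonZero (v l zero)
    vₗ-nonZero = ≢-nonZero vₗ≢0
... | no none = relation-firstCoordinatesZero v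
  (λ l → decidable-stable (v l zero QP.≟ 0ℚ) (λ vₗ≢0 → none (l , vₗ≢0)))
  (nontrivialRelation d (λ j i → v (suc j) (suc i)))

LinIndep⇒spanning : ∀ d (v : Fin d → Point d) → LinIndep v →
  ∀ w → Σ (Fin d → ℚ) λ a → w ≈ sumᵥ (λ j → a j ·ᵥ v j)
LinIndep⇒spanning d v indep w with nontrivialRelation d (w ∷ v)
... | c , rel , l , cₗ≢0 with c zero QP.≟ 0ℚ
...   | yes c₀≡0 = ⊥-elim (cₗ≢0 (c≡0 l))
  where
  relᵥ : sumᵥ (λ j → c (suc j) ·ᵥ v j) ≈ 0ᵥ
  relᵥ i = begin
    sumᵥ (λ j → c (suc j) ·ᵥ v j) i                 ≡⟨ sumᵥ-lookup (λ j → c (suc j) ·ᵥ v j) i ⟩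
    sumℚ (λ j → c (suc j) * v j i)                  ≡⟨ QP.+-identityˡ _ ⟨
    0ℚ + sumℚ (λ j → c (suc j) * v j i)             ≡⟨ cong (_+ sumℚ (λ j → c (suc j) * v j i)) (trans (cong (_* w i) c₀≡0) (QP.*-zeroˡ (w i))) ⟨
    c zero * w i + sumℚ (λ j → c (suc j) * v j i)   ≡⟨ rel i ⟩
    0ℚ                                              ∎
    where open ≡-Reasoning
  c≡0 : ∀ l → c l ≡ 0ℚ
  c≡0 zero = c₀≡0
  c≡0 (suc j) = indep (c ∘ suc) relᵥ j
...   | no c₀≢0 = (λ j → - (c (suc j) * t)) , w≈
  where
  instance
    c₀-nonZero : NonZero (c zero)
    c₀-nonZero = ≢-nonZero c₀≢0
  t : ℚ
  t = 1/ (c zero)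
  w≈ : w ≈ sumᵥ (λ j → (- (c (suc j) * t)) ·ᵥ v j)
  w≈ i = sym (begin
    sumᵥ (λ j → (- (c (suc j) * t)) ·ᵥ v j) i    ≡⟨ sumᵥ-lookup (λ j → (- (c (suc j) * t)) ·ᵥ v j) i ⟩
    sumℚ (λ j → - (c (suc j) * t) * v j i)       ≡⟨ sumℚ-cong (λ j → solve 3 (λ a t x → :- (a :* t) :* x := (:- t) :* (a :* x)) refl (c (suc j)) t (v j i)) ⟩
    sumℚ (λ j → (- t) * (c (suc j) * v j i))     ≡⟨ sumℚ-*ˡ (- t) (λ j → c (suc j) * v j i) ⟩
    (- t) * T                                    ≡⟨ cong (- t *_) T≡ ⟩
    (- t) * (- (c zero * w i))                   ≡⟨ solve 3 (λ t a x → (:- t) :* (:- (a :* x)) := (t :* a) :* x) refl t (c zero) (w i) ⟩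
    (t * c zero) * w i                           ≡⟨ cong (_* w i) (QP.*-inverseˡ (c zero)) ⟩
    1ℚ * w i                                     ≡⟨ QP.*-identityˡ (w i) ⟩
    w i                                          ∎)
    where
    open ≡-Reasoning
    T : ℚ
    T = sumℚ (λ j → c (suc j) * v j i)
    T≡ : T ≡ - (c zero * w i)
    T≡ = trans (solve 2 (λ a b → b := (a :+ b) :- a) refl (c zero * w i) T)
               (trans (cong (_- (c zero * w i)) (rel i)) (QP.+-identityˡ (- (c zero * w i))))

orthogonal⇒≈0 : ∀ d (v : Fin d → Point d) → LinIndep v → (f : Point d) → (∀ j → dot f (v j) ≡ 0ℚ) → f ≈ 0ᵥ
orthogonal⇒≈0 d v indep f f⊥v with LinIndep⇒spanning d v indep f
... | a , f≈ = dot-self≡0⇒≈0 f (begin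
  dot f f                                  ≡⟨ dot-congʳ f f≈ ⟩
  dot f (sumᵥ (λ j → a j ·ᵥ v j))          ≡⟨ dot-linearCombination f a v ⟩
  sumℚ (λ j → a j * dot f (v j))           ≡⟨ sumℚ-zero _ (λ j → trans (cong (a j *_) (f⊥v j)) (QP.*-zeroʳ (a j))) ⟩
  0ℚ                                       ∎)
  where open ≡-Reasoning

constant-on-fullDim⇒≈0 : ∀ {d} {S : PSet d} → DimAtLeast S d → ∀ (f : Point d) b →
  (∀ p → S p → dot f p ≡ b) → f ≈ 0ᵥ
constant-on-fullDim⇒≈0 {d} (p , p∈S , indep) f b f≡b =
  orthogonal⇒≈0 d (λ j → p (suc j) -ᵥ p zero) indep f λ j →
    trans (dot-distribʳ-- f (p (suc j)) (p zero))
          (trans (cong₂ _-_ (f≡b _ (p∈S (suc j))) (f≡b _ (p∈S zero))) (QP.+-inverseʳ b))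

dim≥1⇒distinctPoints : ∀ {d} {S : PSet d} → DimAtLeast S 1 →
  Σ (Point d) λ u → Σ (Point d) λ w → S u × S w × ¬ ((u -ᵥ w) ≈ 0ᵥ)
dim≥1⇒distinctPoints (p , p∈S , indep) =
  p (suc zero) , p zero , p∈S (suc zero) , p∈S zero ,
  λ u-w≈0 → QP.1≢0 (indep (λ _ → 1ℚ) (λ i → trans (QP.+-identityʳ _) (trans (QP.*-identityˡ _) (u-w≈0 i))) zero)

fullDim⇒SpanDiff : ∀ {d} {S : PSet d} → DimAtLeast S d → ∀ v → SpanDiff S v
fullDim⇒SpanDiff {d} (p , p∈S , indep) v with LinIndep⇒spanning d (λ j → p (suc j) -ᵥ p zero) indep v
... | a , v≈ = d , a , p ∘ suc , (λ _ → p zero) , (λ j → p∈S (suc j) , p∈S zero) , v≈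

-- Convex hulls

Conv-resp-≈ : ∀ {m} {S : PSet m} {x y} → Conv S x → x ≈ y → Conv S y
Conv-resp-≈ (r , c , z , c≥0 , Σc≡1 , z∈S , x≈) x≈y = r , c , z , c≥0 , Σc≡1 , z∈S , ≈-trans (≈-sym x≈y) x≈

Conv-mono : ∀ {m} {S T : PSet m} → (∀ x → S x → T x) → ∀ x → Conv S x → Conv T x
Conv-mono S⊆T x (r , c , z , c≥0 , Σc≡1 , z∈S , x≈) = r , c , z , c≥0 , Σc≡1 , (λ l → S⊆T _ (z∈S l)) , x≈

Conv-singleton : ∀ {m} {S : PSet m} {x} → S x → Conv S x
Conv-singleton {x = x} x∈S =
  1 , (λ _ → 1ℚ) , (λ _ → x) , (λ _ → QP.nonNegative⁻¹ 1ℚ) , QP.+-identityʳ 1ℚ , (λ _ → x∈S) ,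
  λ i → sym (trans (QP.+-identityʳ _) (QP.*-identityˡ (x i)))

weighted-cong : ∀ {m} c {x y : Point m} → c ≡ 0ℚ ⊎ x ≈ y → (c ·ᵥ x) ≈ (c ·ᵥ y)
weighted-cong c {x} {y} (inj₁ c≡0) i rewrite c≡0 = trans (QP.*-zeroˡ (x i)) (sym (QP.*-zeroˡ (y i)))
weighted-cong c (inj₂ x≈y) i = cong (c *_) (x≈y i)

combination-++ : ∀ {r d k} (c : Fin r → ℚ) (q : Fin r → Point d) (z : Fin r → Point (d ℕ.+ k)) (h : Point k) →
  sumℚ c ≡ 1ℚ → (∀ l → c l ≡ 0ℚ ⊎ z l ≈ (q l ++ h)) → sumᵥ (λ l → c l ·ᵥ z l) ≈ (sumᵥ (λ l → c l ·ᵥ q l) ++ h)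
combination-++ {d = d} c q z h Σc≡1 z≈ ι =
  trans (sumᵥ-cong (λ l → weighted-cong (c l) (z≈ l)) ι)
        (trans (sumᵥ-lookup (λ l → c l ·ᵥ (q l ++ h)) ι) (by-cases ι))
  where
  by-cases : ∀ ι → sumℚ (λ l → c l * (q l ++ h) ι) ≡ (sumᵥ (λ l → c l ·ᵥ q l) ++ h) ι
  by-cases ι with splitAt d ι
  ... | inj₁ i = sym (sumᵥ-lookup (λ l → c l ·ᵥ q l) i)
  ... | inj₂ j = trans (sumℚ-*ʳ (h j) c) (trans (cong (_* h j) Σc≡1) (QP.*-identityˡ (h j)))

NonNegCombination : ∀ {m} → PSet m → ℚ → Point m → Set
NonNegCombination {m} S w x = Σ ℕ λ R → Σ (Fin R → ℚ) λ e → Σ (Fin R → Point m) λ z →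
  (∀ i → 0ℚ ≤ e i) × (sumℚ e ≡ w) × (∀ i → S (z i)) × (x ≈ sumᵥ (λ i → e i ·ᵥ z i))

combination-flatten : ∀ {m} {S : PSet m} {r} (c : Fin r → ℚ) (y : Fin r → Point m) →
  (∀ i → 0ℚ ≤ c i) → (∀ i → Conv S (y i)) → NonNegCombination S (sumℚ c) (sumᵥ (λ i → c i ·ᵥ y i))
combination-flatten {r = zero} c y _ _ = 0 , (λ ()) , (λ ()) , (λ ()) , refl , (λ ()) , ≈-refl
combination-flatten {m} {S} {suc r} c y c≥0 y∈ConvS
  with y∈ConvS zero | combination-flatten {S = S} (c ∘ suc) (y ∘ suc) (c≥0 ∘ suc) (y∈ConvS ∘ suc)
... | (R₀ , e₀ , z₀ , e₀≥0 , Σe₀≡1 , z₀∈S , y₀≈) | (R , e , z , e≥0 , Σe≡ , z∈S , rest≈) =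
  R₀ ℕ.+ R , E , z₀ ++ z , ++-all (0ℚ ≤_) (λ j → 0≤p*q (c≥0 zero) (e₀≥0 j)) e≥0 , ΣE≡ , ++-all S z₀∈S z∈S , sum≈
  where
  E : Fin (R₀ ℕ.+ R) → ℚ
  E = (λ j → c zero * e₀ j) ++ e
  ΣE≡ : sumℚ E ≡ sumℚ c
  ΣE≡ = trans (sumℚ-++ (λ j → c zero * e₀ j) e)
    (cong₂ _+_ (trans (sumℚ-*ˡ (c zero) e₀) (trans (cong (c zero *_) Σe₀≡1) (QP.*-identityʳ (c zero)))) Σe≡)
  sum≈ : sumᵥ (λ i → c i ·ᵥ y i) ≈ sumᵥ (λ i → E i ·ᵥ (z₀ ++ z) i)
  sum≈ t = sym (begin
    sumᵥ (λ i → E i ·ᵥ (z₀ ++ z) i) t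
      ≡⟨ sumᵥ-lookup (λ i → E i ·ᵥ (z₀ ++ z) i) t ⟩
    sumℚ (λ i → E i * (z₀ ++ z) i t)
      ≡⟨ sumℚ-cong (++-zipWith (λ a p → a * p t) (λ j → c zero * e₀ j) e z₀ z) ⟩
    sumℚ ((λ j → (c zero * e₀ j) * z₀ j t) ++ (λ j → e j * z j t))
      ≡⟨ sumℚ-++ (λ j → (c zero * e₀ j) * z₀ j t) (λ j → e j * z j t) ⟩
    sumℚ (λ j → (c zero * e₀ j) * z₀ j t) + sumℚ (λ j → e j * z j t)
      ≡⟨ cong₂ _+_ first (sym (trans (rest≈ t) (sumᵥ-lookup (λ j → e j ·ᵥ z j) t))) ⟩
    c zero * y zero t + sumᵥ (λ i → c (suc i) ·ᵥ y (suc i)) t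
      ∎)
    where
    open ≡-Reasoning
    first : sumℚ (λ j → (c zero * e₀ j) * z₀ j t) ≡ c zero * y zero t
    first = trans (sumℚ-cong (λ j → QP.*-assoc (c zero) (e₀ j) (z₀ j t)))
      (trans (sumℚ-*ˡ (c zero) (λ j → e₀ j * z₀ j t))
        (cong (c zero *_) (sym (trans (y₀≈ t) (sumᵥ-lookup (λ j → e₀ j ·ᵥ z₀ j) t)))))

Conv-idem : ∀ {m} {S : PSet m} x → Conv (Conv S) x → Conv S x
Conv-idem {S = S} x (r , c , y , c≥0 , Σc≡1 , y∈ConvS , x≈) with combination-flatten {S = S} c y c≥0 y∈ConvS
... | R , e , z , e≥0 , Σe≡ , z∈S , sum≈ = R , e , z , e≥0 , trans Σe≡ Σc≡1 , z∈S , ≈-trans x≈ sum≈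

slack-combination : ∀ {r m} (f : Point m) β (c : Fin r → ℚ) (z : Fin r → Point m) → sumℚ c ≡ 1ℚ →
  β - dot f (sumᵥ (λ l → c l ·ᵥ z l)) ≡ sumℚ (λ l → c l * (β - dot f (z l)))
slack-combination {m = m} f β c z Σc≡1 = sym (begin
  sumℚ (λ l → c l * (β - dot f (z l)))
    ≡⟨ sumℚ-cong (λ l → solve 3 (λ a b e → a :* (b :- e) := a :* b :- a :* e) refl (c l) β (dot f (z l))) ⟩
  sumℚ (λ l → c l * β - c l * dot f (z l))
    ≡⟨ sumℚ-- (λ l → c l * β) (λ l → c l * dot f (z l)) ⟩
  sumℚ (λ l → c l * β) - sumℚ (λ l → c l * dot f (z l))
    ≡⟨ cong₂ _-_ (sumℚ-*ʳ β c) (sym (dot-linearCombination f c z)) ⟩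
  sumℚ c * β - dot f x
    ≡⟨ cong (λ s → s * β - dot f x) Σc≡1 ⟩
  1ℚ * β - dot f x
    ≡⟨ cong (_- dot f x) (QP.*-identityˡ β) ⟩
  β - dot f x
    ∎)
  where
  open ≡-Reasoning
  x : Point m
  x = sumᵥ (λ l → c l ·ᵥ z l)

Conv-≤ : ∀ {m} {S : PSet m} (f : Point m) β → (∀ y → S y → dot f y ≤ β) → ∀ x → Conv S x → dot f x ≤ β
Conv-≤ f β S≤β x (r , c , z , c≥0 , Σc≡1 , z∈S , x≈) =
  subst (_≤ β) (sym (dot-congʳ f x≈))
    (0≤q-p⇒p≤q (subst (0ℚ ≤_) (sym (slack-combination f β c z Σc≡1))
      (sumℚ-nonNeg _ (λ l → 0≤p*q (c≥0 l) (p≤q⇒0≤q-p (S≤β _ (z∈S l)))))))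

combination-tight : ∀ {m} {S : PSet m} (f : Point m) β → (∀ y → S y → dot f y ≤ β) →
  ∀ {r} (c : Fin r → ℚ) (z : Fin r → Point m) → (∀ l → 0ℚ ≤ c l) → sumℚ c ≡ 1ℚ → (∀ l → S (z l)) →
  dot f (sumᵥ (λ l → c l ·ᵥ z l)) ≡ β → ∀ l → c l ≡ 0ℚ ⊎ dot f (z l) ≡ β
combination-tight f β S≤β {r} c z c≥0 Σc≡1 z∈S attains l =
  map₂ q-p≡0⇒p≡q (p*q≡0⇒p≡0∨q≡0 (c l) (β - dot f (z l)) (sumℚ-nonNeg≡0 slack slack≥0 Σslack≡0 l))
  where
  slack : Fin r → ℚ
  slack l = c l * (β - dot f (z l))
  slack≥0 : ∀ l → 0ℚ ≤ slack l
  slack≥0 l = 0≤p*q (c≥0 l) (p≤q⇒0≤q-p (S≤β (z l) (z∈S l)))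
  Σslack≡0 : sumℚ slack ≡ 0ℚ
  Σslack≡0 = trans (sym (slack-combination f β c z Σc≡1)) (trans (cong (λ s → β - s) attains) (QP.+-inverseʳ β))

combination-onHyperplane : ∀ {r m} (f : Point m) β (c : Fin r → ℚ) (z : Fin r → Point m) → sumℚ c ≡ 1ℚ →
  (∀ l → c l ≡ 0ℚ ⊎ dot f (z l) ≡ β) → dot f (sumᵥ (λ l → c l ·ᵥ z l)) ≡ β
combination-onHyperplane f β c z Σc≡1 tight = begin
  dot f (sumᵥ (λ l → c l ·ᵥ z l))  ≡⟨ dot-linearCombination f c z ⟩
  sumℚ (λ l → c l * dot f (z l))   ≡⟨ sumℚ-cong term ⟩
  sumℚ (λ l → c l * β)             ≡⟨ sumℚ-*ʳ β c ⟩
  sumℚ c * β                       ≡⟨ cong (_* β) Σc≡1 ⟩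
  1ℚ * β                           ≡⟨ QP.*-identityˡ β ⟩
  β                                ∎
  where
  open ≡-Reasoning
  term : ∀ l → c l * dot f (z l) ≡ c l * β
  term l with tight l
  ... | inj₁ cₗ≡0 rewrite cₗ≡0 = trans (QP.*-zeroˡ (dot f (z l))) (sym (QP.*-zeroˡ β))
  ... | inj₂ onₗ = cong (c l *_) onₗ

-- Faces and joins

normal : ∀ {m} {C Q : PSet m} → IsFace C Q → Point m
normal = proj₁

bound : ∀ {m} {C Q : PSet m} → IsFace C Q → ℚ
bound F = proj₁ (proj₂ F)

face-valid : ∀ {m} {C Q : PSet m} (F : IsFace C Q) → ∀ x → C x → dot (normal F) x ≤ bound F
face-valid F = proj₁ (proj₂ (proj₂ F))

face-⊆ : ∀ {m} {C Q : PSet m} → IsFace C Q → ∀ {x} → Q x → C x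
face-⊆ (_ , _ , _ , Q≡) {x} x∈Q = proj₁ (proj₁ (Q≡ x) x∈Q)

face-tight : ∀ {m} {C Q : PSet m} (F : IsFace C Q) → ∀ {x} → Q x → dot (normal F) x ≡ bound F
face-tight (_ , _ , _ , Q≡) {x} x∈Q = proj₂ (proj₁ (Q≡ x) x∈Q)

face-∋ : ∀ {m} {C Q : PSet m} (F : IsFace C Q) → ∀ {x} → C x → dot (normal F) x ≡ bound F → Q x
face-∋ (_ , _ , _ , Q≡) {x} x∈C tight = proj₂ (Q≡ x) (x∈C , tight)

face-resp-≈ : ∀ {m} {S Q : PSet m} → IsFace (Conv S) Q → ∀ {x y} → Q x → x ≈ y → Q y
face-resp-≈ {S = S} F x∈Q x≈y =
  face-∋ F (Conv-resp-≈ {S = S} (face-⊆ F x∈Q) x≈y) (trans (dot-congʳ (normal F) (≈-sym x≈y)) (face-tight F x∈Q))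

IsJoinOf-sym : ∀ {m} {C Q₁ Q₂ : PSet m} → IsJoinOf C Q₁ Q₂ → IsJoinOf C Q₂ Q₁
IsJoinOf-sym {Q₁ = Q₁} {Q₂} (F₁ , F₂ , n₁ , n₂ , spans , disjoint , hull) =
  F₂ , F₁ , n₂ , n₁ , (λ v v∈₂ v∈₁ → spans v v∈₁ v∈₂) , (λ x x∈₂ x∈₁ → disjoint x x∈₁ x∈₂) ,
  λ x → (λ x∈ → proj₁ (hull x) (Conv-mono {S = Q₂ ∪ Q₁} (λ _ → swap) x x∈)) ,
        (λ x∈C → Conv-mono {S = Q₁ ∪ Q₂} (λ _ → swap) x (proj₂ (hull x) x∈C))

SpanDiff-difference : ∀ {m} {Q : PSet m} {x y v} → Q x → Q y → v ≈ (x -ᵥ y) → SpanDiff Q v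
SpanDiff-difference {x = x} {y} x∈Q y∈Q v≈ =
  1 , (λ _ → 1ℚ) , (λ _ → x) , (λ _ → y) , (λ _ → x∈Q , y∈Q) ,
  λ i → trans (v≈ i) (sym (trans (QP.+-identityʳ _) (QP.*-identityˡ (x i - y i))))

SpanDiff-lift : ∀ {d k} {S : PSet d} {Q : PSet (d ℕ.+ k)} → (∀ p → S p → Q (p ++ 0ᵥ)) →
  ∀ {v} → SpanDiff S v → SpanDiff Q (v ++ 0ᵥ)
SpanDiff-lift {d} {k} S⊆Q {v} (r , c , x , y , xy∈S , v≈) =
  r , c , (λ i → x i ++ 0ᵥ) , (λ i → y i ++ 0ᵥ) , (λ i → S⊆Q _ (proj₁ (xy∈S i)) , S⊆Q _ (proj₂ (xy∈S i))) ,
  λ ι → trans (by-cases ι) (sym (sumᵥ-lookup (λ i → c i ·ᵥ ((x i ++ 0ᵥ) -ᵥ (y i ++ 0ᵥ))) ι))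
  where
  by-cases : ∀ ι → (v ++ 0ᵥ {k}) ι ≡ sumℚ (λ i → c i * ((x i ++ 0ᵥ {k}) ι - (y i ++ 0ᵥ {k}) ι))
  by-cases ι with splitAt d ι
  ... | inj₁ i = trans (v≈ i) (sumᵥ-lookup (λ i → c i ·ᵥ (x i -ᵥ y i)) i)
  ... | inj₂ j = sym (sumℚ-zero _ (λ i → trans (cong (c i *_) (QP.+-inverseʳ 0ℚ)) (QP.*-zeroʳ (c i))))

-- Levels of a Cayley sum

module CayleyLevels (d k : ℕ) (P : Fin (suc k) → LatticePolytope d)
  (P-nonEmpty : ∀ i → NonEmpty (set (P i))) where

  C : PSet (d ℕ.+ k)
  C = Cayley d k P

  Generator : PSet (d ℕ.+ k)
  Generator y = Σ (Fin (suc k)) λ i → Σ (Point d) λ p → set (P i) p × (y ≈ (p ++ height i))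

  Vertex : Fin (suc k) → PSet d
  Vertex i y = Σ (Fin (N (P i))) λ j → y ≈ (λ t → toℚ (vert (P i) j t))

  generator∈C : ∀ i {p} → set (P i) p → C (p ++ height i)
  generator∈C i {p} p∈Pᵢ = Conv-singleton {S = Generator} (i , p , p∈Pᵢ , ≈-refl)

  -- P i × {height i} is the face of the Cayley sum cut out by levelFunctional i ≤ levelBound i.
  levelFunctional : Fin (suc k) → Point (d ℕ.+ k)
  levelFunctional zero = 0ᵥ {d} ++ (λ _ → - 1ℚ)
  levelFunctional (suc j) = 0ᵥ {d} ++ basis j

  levelBound : Fin (suc k) → ℚ
  levelBound zero = 0ℚ
  levelBound (suc j) = 1ℚ

  dot-0++ : ∀ (g : Point k) p h → dot (0ᵥ ++ g) (p ++ h) ≡ dot g h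
  dot-0++ g p h = trans (dot-++ {d} {k} 0ᵥ p g h) (trans (cong (_+ dot g h) (dot-zeroˡ p)) (QP.+-identityˡ _))

  levelFunctional-same : ∀ i p → dot (levelFunctional i) (p ++ height i) ≡ levelBound i
  levelFunctional-same zero p = trans (dot-0++ (λ _ → - 1ℚ) p 0ᵥ) (dot-zeroʳ {k} (λ _ → - 1ℚ))
  levelFunctional-same (suc j) p = trans (dot-0++ (basis j) p (basis j)) (trans (dot-basis (basis j) j) (basis-diagonal j))

  levelFunctional-other : ∀ i i′ p → i′ ≢ i → dot (levelFunctional i) (p ++ height i′) ≡ levelBound i - 1ℚ
  levelFunctional-other zero zero p i′≢i = ⊥-elim (i′≢i refl)
  levelFunctional-other zero (suc j′) p _ = begin
    dot (levelFunctional zero) (p ++ basis j′)  ≡⟨ dot-0++ (λ _ → - 1ℚ) p (basis j′) ⟩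
    dot (λ _ → - 1ℚ) (basis j′)                 ≡⟨ dot≡sumℚ (λ _ → - 1ℚ) (basis j′) ⟩
    sumℚ (λ i → - 1ℚ * basis j′ i)              ≡⟨ sumℚ-cong (λ i → sym (QP.neg-distribˡ-* 1ℚ (basis j′ i))) ⟩
    sumℚ (λ i → - (1ℚ * basis j′ i))            ≡⟨ sumℚ-neg (λ i → 1ℚ * basis j′ i) ⟩
    - sumℚ (λ i → 1ℚ * basis j′ i)              ≡⟨ cong -_ (trans (sumℚ-*ˡ 1ℚ (basis j′)) (QP.*-identityˡ _)) ⟩
    - sumℚ (basis j′)                           ≡⟨ cong -_ (sumℚ-basis j′) ⟩
    - 1ℚ                                        ≡⟨ QP.+-identityˡ (- 1ℚ) ⟨
    0ℚ - 1ℚ                                     ∎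
    where open ≡-Reasoning
  levelFunctional-other (suc j) zero p _ =
    trans (dot-0++ (basis j) p 0ᵥ) (trans (dot-zeroʳ (basis j)) (sym (QP.+-inverseʳ 1ℚ)))
  levelFunctional-other (suc j) (suc j′) p i′≢i =
    trans (dot-0++ (basis j) p (basis j′))
      (trans (dot-basis (basis j) j′) (trans (basis-offDiagonal j j′ (i′≢i ∘ cong suc ∘ sym)) (sym (QP.+-inverseʳ 1ℚ))))

  generator-≤ : ∀ i y → Generator y → dot (levelFunctional i) y ≤ levelBound i
  generator-≤ i y (i′ , p , _ , y≈) rewrite dot-congʳ (levelFunctional i) y≈ with i′ FinP.≟ i
  ... | yes refl = QP.≤-reflexive (levelFunctional-same i p)
  ... | no i′≢i = subst (_≤ levelBound i) (sym (levelFunctional-other i i′ p i′≢i))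
        (0≤q-p⇒p≤q (subst (0ℚ ≤_) (solve 1 (λ b → con 1ℚ := b :- (b :- con 1ℚ)) refl (levelBound i)) (QP.nonNegative⁻¹ 1ℚ)))

  C-≤ : ∀ i x → C x → dot (levelFunctional i) x ≤ levelBound i
  C-≤ i = Conv-≤ (levelFunctional i) (levelBound i) (generator-≤ i)

  OnLevel : Fin (suc k) → PSet (d ℕ.+ k)
  OnLevel i x = Σ (Point d) λ q → set (P i) q × (x ≈ (q ++ height i))

  generator-onLevel : ∀ i {y} → Generator y → dot (levelFunctional i) y ≡ levelBound i → OnLevel i y
  generator-onLevel i (i′ , p , p∈ , y≈) attains with i′ FinP.≟ i
  ... | yes refl = p , p∈ , y≈
  ... | no i′≢i = ⊥-elim (QP.1≢0 (begin
    1ℚ                        ≡⟨ solve 1 (λ b → con 1ℚ := b :- (b :- con 1ℚ)) refl (levelBound i) ⟩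
    b - (b - 1ℚ)              ≡⟨ cong (λ s → b - s) (trans (sym (levelFunctional-other i i′ p i′≢i)) (trans (dot-congʳ (levelFunctional i) (≈-sym y≈)) attains)) ⟩
    b - b                     ≡⟨ QP.+-inverseʳ b ⟩
    0ℚ                        ∎))
    where
    open ≡-Reasoning
    b : ℚ
    b = levelBound i

  representative : ∀ i {c z} → c ≡ 0ℚ ⊎ OnLevel i z → Σ (Point d) λ q → set (P i) q × (c ≡ 0ℚ ⊎ z ≈ (q ++ height i))
  representative i (inj₁ c≡0) = proj₁ (P-nonEmpty i) , proj₂ (P-nonEmpty i) , inj₁ c≡0
  representative i (inj₂ (q , q∈ , z≈)) = q , q∈ , inj₂ z≈

  C-onLevel : ∀ i {x} → C x → dot (levelFunctional i) x ≡ levelBound i → OnLevel i x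
  C-onLevel i {x} (r , c , z , c≥0 , Σc≡1 , z∈Gen , x≈) attains =
    sumᵥ (λ l → c l ·ᵥ q l) ,
    Conv-idem {S = Vertex i} _ (r , c , q , c≥0 , Σc≡1 , (λ l → proj₁ (proj₂ (chosen l))) , ≈-refl) ,
    ≈-trans x≈ (combination-++ c q z (height i) Σc≡1 (λ l → proj₂ (proj₂ (chosen l))))
    where
    chosen : ∀ l → Σ (Point d) λ q → set (P i) q × (c l ≡ 0ℚ ⊎ z l ≈ (q ++ height i))
    chosen l = representative i (map₂ (generator-onLevel i (z∈Gen l))
      (combination-tight (levelFunctional i) (levelBound i) (generator-≤ i) c z c≥0 Σc≡1 z∈Gen
        (trans (dot-congʳ (levelFunctional i) (≈-sym x≈)) attains) l))
    q : Fin r → Point d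
    q l = proj₁ (chosen l)

  combination-onLevel : ∀ i {S : PSet (d ℕ.+ k)} → (∀ y → S y → C y) →
    ∀ {r} (c : Fin r → ℚ) (z : Fin r → Point (d ℕ.+ k)) → (∀ l → 0ℚ ≤ c l) → sumℚ c ≡ 1ℚ → (∀ l → S (z l)) →
    ∀ {p} → (p ++ height i) ≈ sumᵥ (λ l → c l ·ᵥ z l) → ∀ l → c l ≡ 0ℚ ⊎ OnLevel i (z l)
  combination-onLevel i S⊆C c z c≥0 Σc≡1 z∈S {p} p≈ l =
    map₂ (C-onLevel i (S⊆C _ (z∈S l)))
      (combination-tight (levelFunctional i) (levelBound i) (λ y y∈S → C-≤ i y (S⊆C y y∈S)) c z c≥0 Σc≡1 z∈S
        (trans (dot-congʳ (levelFunctional i) (≈-sym p≈)) (levelFunctional-same i p)) l)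

-- Joins of Cayley sums

module CayleyJoins (d k : ℕ) (P : Fin (suc k) → LatticePolytope d)
  (dim₀ : DimAtLeast (set (P zero)) d) (dim≥1 : ∀ i → DimAtLeast (set (P i)) 1) where

  open CayleyLevels d k P (λ i → proj₁ (dim≥1 i) zero , proj₁ (proj₂ (dim≥1 i)) zero)

  P₀ : PSet d
  P₀ = set (P zero)

  trace : PSet (d ℕ.+ k) → PSet d
  trace Q p = P₀ p × Q (p ++ 0ᵥ)

  join-⊆ : ∀ {Q₁ Q₂} → IsJoinOf C Q₁ Q₂ → ∀ y → (Q₁ ∪ Q₂) y → C y
  join-⊆ (F₁ , _) y (inj₁ y∈Q₁) = face-⊆ F₁ y∈Q₁
  join-⊆ (_ , F₂ , _) y (inj₂ y∈Q₂) = face-⊆ F₂ y∈Q₂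

  level⊆face : ∀ {Q₁ Q₂} → IsJoinOf C Q₁ Q₂ → ∀ i → (∀ q → set (P i) q → ¬ Q₂ (q ++ height i)) →
    ∀ p → set (P i) p → Q₁ (p ++ height i)
  level⊆face {Q₁} {Q₂} J@(F₁ , F₂ , _ , _ , _ , _ , hull) i Q₂-avoids p p∈ =
    fromDecomposition (proj₂ (hull (p ++ height i)) (generator∈C i p∈))
    where
    tight : ∀ {c z} → c ≡ 0ℚ ⊎ OnLevel i z → (Q₁ ∪ Q₂) z → c ≡ 0ℚ ⊎ dot (normal F₁) z ≡ bound F₁
    tight (inj₁ c≡0) _ = inj₁ c≡0
    tight (inj₂ _) (inj₁ z∈Q₁) = inj₂ (face-tight F₁ z∈Q₁)
    tight (inj₂ (q , q∈ , z≈)) (inj₂ z∈Q₂) = ⊥-elim (Q₂-avoids q q∈ (face-resp-≈ {S = Generator} F₂ z∈Q₂ z≈))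
    fromDecomposition : Conv (Q₁ ∪ Q₂) (p ++ height i) → Q₁ (p ++ height i)
    fromDecomposition (r , c , z , c≥0 , Σc≡1 , z∈Q , p≈) =
      face-∋ F₁ (generator∈C i p∈) (trans (dot-congʳ (normal F₁) p≈)
        (combination-onHyperplane (normal F₁) (bound F₁) c z Σc≡1
          (λ l → tight (combination-onLevel i (join-⊆ J) c z c≥0 Σc≡1 z∈Q p≈ l) (z∈Q l))))

  trace-face : ∀ {Q} → IsFace C Q → IsFace P₀ (trace Q)
  trace-face {Q} F = f , bound F , valid , λ p → (λ { (p∈ , p∈Q) → p∈ , trans (sym (dot-base p)) (face-tight F p∈Q) }) ,
                                              (λ { (p∈ , tight) → p∈ , face-∋ F (generator∈C zero p∈) (trans (dot-base p) tight) })
    where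
    f : Point d
    f i = normal F (i ↑ˡ k)
    dot-base : ∀ p → dot (normal F) (p ++ 0ᵥ) ≡ dot f p
    dot-base p = trans (dot-split d k (normal F) p 0ᵥ) (trans (cong (dot f p +_) (dot-zeroʳ (λ j → normal F (d ↑ʳ j)))) (QP.+-identityʳ _))
    valid : ∀ p → P₀ p → dot f p ≤ bound F
    valid p p∈ = subst (_≤ bound F) (dot-base p) (face-valid F _ (generator∈C zero p∈))

  trace-hull : ∀ {Q₁ Q₂} → IsJoinOf C Q₁ Q₂ → NonEmpty (trace Q₁) → ∀ x → P₀ x → Conv (trace Q₁ ∪ trace Q₂) x
  trace-hull {Q₁} {Q₂} J@(F₁ , F₂ , _ , _ , _ , _ , hull) (x₁ , x₁∈) x x∈ =
    fromDecomposition (proj₂ (hull (x ++ 0ᵥ)) (generator∈C zero x∈))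
    where
    traceRepresentative : ∀ {c z} → c ≡ 0ℚ ⊎ OnLevel zero z → (Q₁ ∪ Q₂) z →
      Σ (Point d) λ q → (trace Q₁ ∪ trace Q₂) q × (c ≡ 0ℚ ⊎ z ≈ (q ++ 0ᵥ))
    traceRepresentative (inj₁ c≡0) _ = x₁ , inj₁ x₁∈ , inj₁ c≡0
    traceRepresentative (inj₂ (q , q∈ , z≈)) (inj₁ z∈Q₁) = q , inj₁ (q∈ , face-resp-≈ {S = Generator} F₁ z∈Q₁ z≈) , inj₂ z≈
    traceRepresentative (inj₂ (q , q∈ , z≈)) (inj₂ z∈Q₂) = q , inj₂ (q∈ , face-resp-≈ {S = Generator} F₂ z∈Q₂ z≈) , inj₂ z≈
    fromDecomposition : Conv (Q₁ ∪ Q₂) (x ++ 0ᵥ) → Conv (trace Q₁ ∪ trace Q₂) x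
    fromDecomposition (r , c , z , c≥0 , Σc≡1 , z∈Q , x≈) =
      r , c , q , c≥0 , Σc≡1 , (λ l → proj₁ (proj₂ (chosen l))) ,
      ++-injectiveˡ x _ (≈-trans x≈ (combination-++ c q z 0ᵥ Σc≡1 (λ l → proj₂ (proj₂ (chosen l)))))
      where
      chosen : ∀ l → Σ (Point d) λ q → (trace Q₁ ∪ trace Q₂) q × (c l ≡ 0ℚ ⊎ z l ≈ (q ++ 0ᵥ))
      chosen l = traceRepresentative (combination-onLevel zero (join-⊆ J) c z c≥0 Σc≡1 z∈Q x≈ l) (z∈Q l)
      q : Fin r → Point d
      q l = proj₁ (chosen l)

  traces-join : ∀ {Q₁ Q₂} → IsJoinOf C Q₁ Q₂ → NonEmpty (trace Q₁) → NonEmpty (trace Q₂) →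
    IsJoinOf P₀ (trace Q₁) (trace Q₂)
  traces-join {Q₁} {Q₂} J@(F₁ , F₂ , _ , _ , spans , disjoint , _) ne₁ ne₂ =
    trace-face F₁ , trace-face F₂ , ne₁ , ne₂ ,
    (λ v v∈₁ v∈₂ i → trans (sym (lookup-++ˡ v 0ᵥ i))
                       (spans (v ++ 0ᵥ) (SpanDiff-lift {S = trace Q₁} {Q₁} (λ _ → proj₂) v∈₁) (SpanDiff-lift {S = trace Q₂} {Q₂} (λ _ → proj₂) v∈₂) (i ↑ˡ k))) ,
    (λ x x∈₁ x∈₂ → disjoint (x ++ 0ᵥ) (proj₂ x∈₁) (proj₂ x∈₂)) ,
    λ x → (λ x∈ → Conv-idem {S = Vertex zero} x (Conv-mono {S = trace Q₁ ∪ trace Q₂} (λ _ → [ proj₁ , proj₁ ]′) x x∈)) ,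
          trace-hull J ne₁ x

  module _ {Q₁ Q₂} (J : IsJoinOf C Q₁ Q₂) (base⊆Q₁ : ∀ p → P₀ p → Q₁ (p ++ 0ᵥ)) where

    private
      F₁ : IsFace C Q₁
      F₁ = proj₁ J

      spans : ∀ v → SpanDiff Q₁ v → SpanDiff Q₂ v → v ≈ 0ᵥ
      spans = proj₁ (proj₂ (proj₂ (proj₂ (proj₂ J))))

      horizontal : Point d
      horizontal i = normal F₁ (i ↑ˡ k)

      vertical : Point k
      vertical j = normal F₁ (d ↑ʳ j)

      horizontal-onBase : ∀ p → P₀ p → dot horizontal p ≡ bound F₁
      horizontal-onBase p p∈ = begin
        dot horizontal p                          ≡⟨ QP.+-identityʳ _ ⟨
        dot horizontal p + 0ℚ                     ≡⟨ cong (dot horizontal p +_) (dot-zeroʳ vertical) ⟨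
        dot horizontal p + dot vertical 0ᵥ        ≡⟨ dot-split d k (normal F₁) p 0ᵥ ⟨
        dot (normal F₁) (p ++ 0ᵥ)                 ≡⟨ face-tight F₁ (base⊆Q₁ p p∈) ⟩
        bound F₁                                  ∎
        where open ≡-Reasoning

      horizontal≈0 : horizontal ≈ 0ᵥ
      horizontal≈0 = constant-on-fullDim⇒≈0 dim₀ horizontal (bound F₁) horizontal-onBase

      bound≡0 : bound F₁ ≡ 0ℚ
      bound≡0 = trans (sym (horizontal-onBase (proj₁ dim₀ zero) (proj₁ (proj₂ dim₀) zero)))
                      (trans (dot-cong horizontal≈0 ≈-refl) (dot-zeroˡ (proj₁ dim₀ zero)))

      dot-normal : ∀ x y → dot (normal F₁) (x ++ y) ≡ dot vertical y
      dot-normal x y = trans (dot-split d k (normal F₁) x y)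
        (trans (cong (_+ dot vertical y) (trans (dot-cong horizontal≈0 ≈-refl) (dot-zeroˡ x))) (QP.+-identityˡ _))

      -- Otherwise the level of P (suc j) avoids Q₁, hence lies in Q₂, and its edge directions would
      -- lie in both difference spans, since Q₁ ⊇ P₀ × {0} spans all horizontal directions.
      vertical≢0⇒⊥ : ∀ j → vertical j ≢ 0ℚ → ⊥
      vertical≢0⇒⊥ j vⱼ≢0 with dim≥1⇒distinctPoints {S = set (P (suc j))} (dim≥1 (suc j))
      ... | u , w , u∈ , w∈ , u-w≉0 = u-w≉0 (λ i → trans (sym (lookup-++ˡ (u -ᵥ w) 0ᵥ i)) (edge≈0 (i ↑ˡ k)))
        where
        level-avoids-Q₁ : ∀ q → set (P (suc j)) q → ¬ Q₁ (q ++ basis j)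
        level-avoids-Q₁ q _ q∈Q₁ = vⱼ≢0 (begin
          vertical j                      ≡⟨ dot-basis vertical j ⟨
          dot vertical (basis j)          ≡⟨ dot-normal q (basis j) ⟨
          dot (normal F₁) (q ++ basis j)  ≡⟨ face-tight F₁ q∈Q₁ ⟩
          bound F₁                        ≡⟨ bound≡0 ⟩
          0ℚ                              ∎)
          where open ≡-Reasoning
        level⊆Q₂ : ∀ p → set (P (suc j)) p → Q₂ (p ++ basis j)
        level⊆Q₂ = level⊆face (IsJoinOf-sym J) (suc j) level-avoids-Q₁
        edge≈0 : ((u -ᵥ w) ++ 0ᵥ) ≈ 0ᵥ
        edge≈0 = spans ((u -ᵥ w) ++ 0ᵥ)
          (SpanDiff-lift {S = P₀} {Q₁} base⊆Q₁ (fullDim⇒SpanDiff {S = P₀} dim₀ (u -ᵥ w)))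
          (SpanDiff-difference {Q = Q₂} (level⊆Q₂ u u∈) (level⊆Q₂ w w∈) (≈-sym (++-difference u w (basis j))))

      vertical≡0 : ∀ j → vertical j ≡ 0ℚ
      vertical≡0 j = decidable-stable (vertical j QP.≟ 0ℚ) (vertical≢0⇒⊥ j)

      normal≈0 : normal F₁ ≈ 0ᵥ
      normal≈0 ι = trans (take++drop d k (normal F₁) ι) (++-all (_≡ 0ℚ) horizontal≈0 vertical≡0 ι)

    base⊆face⇒C⊆face : ∀ {x} → C x → Q₁ x
    base⊆face⇒C⊆face {x} x∈C =
      face-∋ F₁ x∈C (trans (dot-cong normal≈0 ≈-refl) (trans (dot-zeroˡ x) (sym bound≡0)))

  base⊆face⇒⊥ : ∀ {Q₁ Q₂} → IsJoinOf C Q₁ Q₂ → (∀ p → P₀ p → Q₁ (p ++ 0ᵥ)) → ⊥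
  base⊆face⇒⊥ J@(_ , F₂ , _ , (x , x∈Q₂) , _ , disjoint , _) base⊆Q₁ =
    disjoint x (base⊆face⇒C⊆face J base⊆Q₁ (face-⊆ F₂ x∈Q₂)) x∈Q₂

  emptyTrace⇒base⊆face : ∀ {Q₁ Q₂} → IsJoinOf C Q₁ Q₂ → ¬ NonEmpty (trace Q₂) → ∀ p → P₀ p → Q₁ (p ++ 0ᵥ)
  emptyTrace⇒base⊆face J ¬ne = level⊆face J zero (λ q q∈ q∈Q₂ → ¬ne (q , q∈ , q∈Q₂))

-- Emptiness of a trace is not decidable, so both case splits are made under a negation.
proposition6p24 : (d k : ℕ) (P : Fin (suc k) → LatticePolytope d) →
    IsBk d k P →
    (∀ i → DimAtLeast (set (P i)) 1) →
    ¬ IsJoin (set (P zero)) →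
    ¬ IsJoin (Cayley d k P)
proposition6p24 d k P (_ , dim₀ , _) dim≥1 ¬join (Q₁ , Q₂ , J) =
  base⊆face⇒⊥ J (emptyTrace⇒base⊆face J λ ne₂ →
    base⊆face⇒⊥ J′ (emptyTrace⇒base⊆face J′ λ ne₁ →
      ¬join (trace Q₁ , trace Q₂ , traces-join J ne₁ ne₂)))
  where
  open CayleyJoins d k P dim₀ dim≥1
  J′ : IsJoinOf (Cayley d k P) Q₂ Q₁
  J′ = IsJoinOf-sym J
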